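{- For any two integers $m,s\ge 2$ there exists a proper, thin 2-qBMG on $2ms$ vertices whose color-preserving automorphism group contains a subgroup isomorphic to $\mathrm{Sym}_m$.
   Context: A digraph $\overrightarrow{G}=\overrightarrow{G}(V,E)$ has a finite vertex set $V$ and edge set $E\subseteq V\times V$ without loops ($uv$ denotes the edge with tail $u$ and head $v$; symmetric edges allowed). $N^+(v)=\{w:vw\in E\}$, $N^-(v)=\{w:wv\in E\}$. Two vertices $u,v$ are independent if neither $uv$ nor $vu$ is in $E$. A 2-qBMG is a digraph, equipped with a partition $V=U\cup W$ into two color classes such that every edge joins a vertex of $U$ and a vertex of $W$, satisfying: (N1) if $u,v$ are independent then there are no vertices $w,t$ with $ut,vw,tw\in E$; (N2) if $uv,vw,wt\in E$ then $ut\in E$; (N3) if $u,v$ have a common out-neighbor then $N^+(u)\subseteq N^+(v)$ or $N^+(v)\subseteq N^+(u)$. A 2-qBMG is proper if (N2) is non-trivial, i.e. there exist vertices $u,v,w,t$ with $uv,vw,wt\in E$. It is thin if no two distinct vertices $x,y$ satisfy both $N^+(x)=N^+(y)$ and $N^-(x)=N^-(y)$. The color-preserving automorphism group $\mathrm{Aut}_I(\overrightarrow{G})$ consists of the permutations $\pi$ of $V$ mapping $U$ to $U$, $W$ to $W$, with $xy\in E\Rightarrow\pi(x)\pi(y)\in E$. $\mathrm{Sym}_m$ is the symmetric group on $m$ letters. -}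

module Defs where

open import Data.Nat using (ℕ)
open import Data.Fin using (Fin)
open import Data.Fin.Permutation using (Permutation′; _⟨$⟩ʳ_; _∘ₚ_)
open import Data.Bool using (Bool; true; false)
open import Data.Product using (Σ; ∃; _×_; _,_)
open import Data.Sum using (_⊎_)
open import Relation.Nullary using (¬_)
open import Relation.Binary.PropositionalEquality using (_≡_; _≢_)

-- A finite digraph on the vertex set Fin n, given by its (Boolean)
-- adjacency relation, together with a 2-colouring  V = U ∪ W
-- (colour true = U, colour false = W).
record ColDigraph (n : ℕ) : Set where
  field
    adj    : Fin n → Fin n → Bool
    colour : Fin n → Bool

module _ {n : ℕ} (G : ColDigraph n) where
  open ColDigraph G

  E : Fin n → Fin n → Set
  E u v = adj u v ≡ true

  Loopless : Set
  Loopless = ∀ v → ¬ E v v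

  Bipartite : Set
  Bipartite = ∀ u v → E u v → colour u ≢ colour v

  Independent : Fin n → Fin n → Set
  Independent u v = ¬ E u v × ¬ E v u

  OutSub : Fin n → Fin n → Set
  OutSub u v = ∀ x → E u x → E v x

  N1 : Set
  N1 = ∀ u v → Independent u v →
       ¬ (Σ (Fin n) λ w → Σ (Fin n) λ t → E u t × E v w × E t w)

  N2 : Set
  N2 = ∀ u v w t → E u v → E v w → E w t → E u t

  N3 : Set
  N3 = ∀ u v → (Σ (Fin n) λ x → E u x × E v x) → OutSub u v ⊎ OutSub v u

  Is2qBMG : Set
  Is2qBMG = Loopless × Bipartite × N1 × N2 × N3

  Proper : Set
  Proper = Σ (Fin n) λ u → Σ (Fin n) λ v → Σ (Fin n) λ w → Σ (Fin n) λ t →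
           E u v × E v w × E w t

  Thin : Set
  Thin = ∀ x y → x ≢ y →
         ¬ ((∀ z → adj x z ≡ adj y z) × (∀ z → adj z x ≡ adj z y))

  IsColAut : Permutation′ n → Set
  IsColAut π = (∀ x → colour (π ⟨$⟩ʳ x) ≡ colour x) ×
               (∀ x y → E x y → E (π ⟨$⟩ʳ x) (π ⟨$⟩ʳ y))

  -- Aut_I(G) contains a subgroup isomorphic to Sym_m, i.e. there is an
  -- injective group homomorphism Sym_m → Aut_I(G), where Sym_m is the
  -- group of permutations of Fin m (equality of permutations is
  -- pointwise equality of the underlying maps).
  ContainsSym : ℕ → Set
  ContainsSym m =
    Σ (Permutation′ m → Permutation′ n) λ φ →
      (∀ σ → IsColAut (φ σ)) ×
      (∀ σ τ x → φ (σ ∘ₚ τ) ⟨$⟩ʳ x ≡ (φ σ ∘ₚ φ τ) ⟨$⟩ʳ x) ×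
      (∀ σ τ → (∀ x → φ σ ⟨$⟩ʳ x ≡ φ τ ⟨$⟩ʳ x) → ∀ i → σ ⟨$⟩ʳ i ≡ τ ⟨$⟩ʳ i)

{-# OPTIONS --safe #-}
-- Take m disjoint copies of the digraph on the levels 0, …, 2s − 1 with an edge a → b
-- whenever a < b and a, b have opposite parity, and colour each vertex by the parity of
-- its level. Parities alternate along a path, so a path with three edges joins levels of
-- opposite parity and is shortcut by an edge (N2); two vertices with a common
-- out-neighbour have equal parity, and the lower one sees everything the higher one sees
-- (N3); in the configuration of (N1) u and v have opposite parities, hence are adjacent.
-- Within a copy a lower vertex is told apart from a higher one by the level just above
-- it, or by the higher vertex itself; vertices of different copies are told apart by any
-- neighbour, which exists once there are two levels. Permuting the copies embeds Sym_m
-- into Aut_I, and s ≥ 2 leaves room for a path with three edges.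
module Submission where

open import Defs
open import Data.Nat using (ℕ; _≤_; _*_)
open import Data.Product using (Σ; _×_)

open import Data.Bool.Base using (Bool; true; not)
open import Data.Bool.Properties using (¬-not; not-¬) renaming (_≟_ to _≟ᵇ_)
open import Data.Empty using (⊥-elim)
open import Data.Fin.Base using (Fin; toℕ; fromℕ<)
open import Data.Fin.Patterns using (0F)
open import Data.Fin.Permutation using (Permutation′; _⟨$⟩ʳ_; _⟨$⟩ˡ_; _∘ₚ_; permutation; inverseˡ; inverseʳ)
open import Data.Fin.Properties using (toℕ-injective; toℕ-fromℕ<; toℕ<n; *↔×) renaming (_≟_ to _≟ᶠ_)
open import Data.Nat.Base using (zero; suc; _<_; s≤s; z≤n)
open import Data.Nat.Properties
  using (_<?_; <-cmp; ≤-total; ≤-antisym; ≮⇒≥; <⇒≱; <-trans; <-irrefl; ≤-<-trans; n<1+n; *-comm; *-assoc; *-monoʳ-≤)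
open import Data.Product using (_,_; proj₁; proj₂; ∃; map₁)
open import Data.Sum using (_⊎_; inj₁; inj₂; [_,_]′)
open import Function.Base using (_∘_)
open import Function.Bundles using (_↔_; Inverse; Injection)
open import Function.Properties.Inverse using (↔⇒↣)
open import Relation.Binary.Definitions using (tri<; tri≈; tri>)
open import Relation.Nullary using (¬_; Dec; yes; no; does; proof)
open import Relation.Nullary.Reflects using (Reflects; invert)
open import Relation.Nullary.Decidable using (_×-dec_; ¬?; dec-true)
open import Relation.Binary.PropositionalEquality

isEven : ℕ → Bool
isEven zero    = true
isEven (suc n) = not (isEven n)

infix 4 _⋖_ _⋖?_

_⋖_ : ℕ → ℕ → Set
a ⋖ b = a < b × isEven a ≢ isEven b

_⋖?_ : ∀ a b → Dec (a ⋖ b)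
a ⋖? b = a <? b ×-dec ¬? (isEven a ≟ᵇ isEven b)

≢-≢⇒≡ : ∀ {x y z : Bool} → x ≢ y → y ≢ z → x ≡ z
≢-≢⇒≡ x≢y y≢z = trans (¬-not x≢y) (sym (¬-not (y≢z ∘ sym)))

⋖-irrefl : ∀ {a} → ¬ a ⋖ a
⋖-irrefl (a<a , _) = <-irrefl refl a<a

n⋖1+n : ∀ n → n ⋖ suc n
n⋖1+n n = n<1+n n , not-¬ refl

⋖-⋖⇒isEven≡ : ∀ {a b c} → a ⋖ b → b ⋖ c → isEven a ≡ isEven c
⋖-⋖⇒isEven≡ (_ , a≢b) (_ , b≢c) = ≢-≢⇒≡ a≢b b≢c

⋖-trans₃ : ∀ {a b c d} → a ⋖ b → b ⋖ c → c ⋖ d → a ⋖ d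
⋖-trans₃ a⋖b@(a<b , _) b⋖c@(b<c , _) (c<d , c≢d) =
  <-trans a<b (<-trans b<c c<d) , subst (_≢ _) (sym (⋖-⋖⇒isEven≡ a⋖b b⋖c)) c≢d

≤-⋖-trans : ∀ {a b c} → a ≤ b → isEven a ≡ isEven b → b ⋖ c → a ⋖ c
≤-⋖-trans a≤b a≡b (b<c , b≢c) = ≤-<-trans a≤b b<c , subst (_≢ _) (sym a≡b) b≢c

isEven≢⇒⋖-connex : ∀ {a b} → isEven a ≢ isEven b → a ⋖ b ⊎ b ⋖ a
isEven≢⇒⋖-connex {a} {b} a≢b with <-cmp a b
... | tri< a<b _ _ = inj₁ (a<b , a≢b)
... | tri≈ _ refl _ = ⊥-elim (a≢b refl)
... | tri> _ _ b<a = inj₂ (b<a , a≢b ∘ sym)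

⋖-neighbour : ∀ {K} a → 1 < K → a < K → ∃ λ b → b < K × (a ⋖ b ⊎ b ⋖ a)
⋖-neighbour zero    1<K _   = 1 , 1<K , inj₁ (n⋖1+n 0)
⋖-neighbour (suc a) _   a<K = a , <-trans (n<1+n a) a<K , inj₂ (n⋖1+n a)

⋖-separating : ∀ {K a b} → a < b → b < K → ∃ λ c → c < K × a ⋖ c × ¬ b ⋖ c
⋖-separating {a = a} {b} a<b b<K with isEven a ≟ᵇ isEven b
... | no a≢b = b , b<K , (a<b , a≢b) , ⋖-irrefl
... | yes _  = suc a , ≤-<-trans a<b b<K , n⋖1+n a , λ (b<1+a , _) → <⇒≱ b<1+a a<b

module CopiesOfAlternatingPath {n m K : ℕ} (split : Fin n ↔ (Fin m × Fin K)) where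
  open Inverse split using (to; from; strictlyInverseˡ; strictlyInverseʳ)

  copy : Fin n → Fin m
  copy v = proj₁ (to v)

  level : Fin n → ℕ
  level v = toℕ (proj₂ (to v))

  Edge : Fin n → Fin n → Set
  Edge u v = copy u ≡ copy v × level u ⋖ level v

  edge? : ∀ u v → Dec (Edge u v)
  edge? u v = copy u ≟ᶠ copy v ×-dec level u ⋖? level v

  G : ColDigraph n
  G = record { adj = λ u v → does (edge? u v) ; colour = isEven ∘ level }

  open ColDigraph G using (adj)

  E⇒Edge : ∀ {u v} → E G u v → Edge u v
  E⇒Edge {u} {v} e = invert (subst (Reflects (Edge u v)) e (proof (edge? u v)))

  Edge⇒E : ∀ {u v} → Edge u v → E G u v
  Edge⇒E {u} {v} = dec-true (edge? u v)

  Edge-resp-adj : ∀ {u v u′ v′} → adj u v ≡ adj u′ v′ → Edge u v → Edge u′ v′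
  Edge-resp-adj eq = E⇒Edge ∘ trans (sym eq) ∘ Edge⇒E

  vertex : Fin m → (a : ℕ) → .(a < K) → Fin n
  vertex i a a<K = from (i , fromℕ< a<K)

  copy-from : ∀ i j → copy (from (i , j)) ≡ i
  copy-from i j = cong proj₁ (strictlyInverseˡ (i , j))

  level-vertex : ∀ i a .(a<K : a < K) → level (vertex i a a<K) ≡ a
  level-vertex i a a<K = trans (cong (toℕ ∘ proj₂) (strictlyInverseˡ _)) (toℕ-fromℕ< a<K)

  Edge-vertex : ∀ i {a b} .(a<K : a < K) .(b<K : b < K) → a ⋖ b →
                Edge (vertex i a a<K) (vertex i b b<K)
  Edge-vertex i {a} {b} a<K b<K a⋖b =
    trans (copy-from i _) (sym (copy-from i _)) ,
    subst₂ _⋖_ (sym (level-vertex i a a<K)) (sym (level-vertex i b b<K)) a⋖b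

  Edge-to-vertex : ∀ u {b} .(b<K : b < K) → level u ⋖ b → Edge u (vertex (copy u) b b<K)
  Edge-to-vertex u {b} b<K u⋖b =
    sym (copy-from (copy u) _) , subst (level u ⋖_) (sym (level-vertex (copy u) b b<K)) u⋖b

  Edge-from-vertex : ∀ u {b} .(b<K : b < K) → b ⋖ level u → Edge (vertex (copy u) b b<K) u
  Edge-from-vertex u {b} b<K b⋖u =
    copy-from (copy u) _ , subst (_⋖ level u) (sym (level-vertex (copy u) b b<K)) b⋖u

  loopless : Loopless G
  loopless v = ⋖-irrefl ∘ proj₂ ∘ E⇒Edge

  bipartite : Bipartite G
  bipartite u v = proj₂ ∘ proj₂ ∘ E⇒Edge

  n1 : N1 G
  n1 u v (¬uv , ¬vu) (w , t , ut , vw , tw) =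
    let (cut , lut) = E⇒Edge ut
        (cvw , (_ , v≢w)) = E⇒Edge vw
        (ctw , ltw) = E⇒Edge tw
        cuv = trans cut (trans ctw (sym cvw))
        u≢v = λ u≡v → v≢w (trans (sym u≡v) (⋖-⋖⇒isEven≡ lut ltw))
    in [ ¬uv ∘ Edge⇒E ∘ (cuv ,_) , ¬vu ∘ Edge⇒E ∘ (sym cuv ,_) ]′ (isEven≢⇒⋖-connex u≢v)

  n2 : N2 G
  n2 u v w t uv vw wt =
    let (cuv , luv) = E⇒Edge uv
        (cvw , lvw) = E⇒Edge vw
        (cwt , lwt) = E⇒Edge wt
    in Edge⇒E (trans cuv (trans cvw cwt) , ⋖-trans₃ luv lvw lwt)

  OutSub-lower : ∀ {u v} → copy u ≡ copy v → level u ≤ level v →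
                 isEven (level u) ≡ isEven (level v) → OutSub G v u
  OutSub-lower cuv u≤v u≡v y vy =
    let (cvy , lvy) = E⇒Edge vy
    in Edge⇒E (trans cuv cvy , ≤-⋖-trans u≤v u≡v lvy)

  OutSub-comparable : ∀ {u v} → copy u ≡ copy v → isEven (level u) ≡ isEven (level v) →
                      OutSub G u v ⊎ OutSub G v u
  OutSub-comparable {u} {v} cuv u≡v with ≤-total (level u) (level v)
  ... | inj₁ u≤v = inj₂ (OutSub-lower cuv u≤v u≡v)
  ... | inj₂ v≤u = inj₁ (OutSub-lower (sym cuv) v≤u (sym u≡v))

  n3 : N3 G
  n3 u v (x , ux , vx) =
    let (cux , lux) = E⇒Edge ux
        (cvx , lvx) = E⇒Edge vx
    in OutSub-comparable (trans cux (sym cvx)) (≢-≢⇒≡ (proj₂ lux) (proj₂ lvx ∘ sym))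

  is2qBMG : Is2qBMG G
  is2qBMG = loopless , bipartite , n1 , n2 , n3

  proper : Fin m → 4 ≤ K → Proper G
  proper i 4≤K =
    vertex i 0 0<K , vertex i 1 1<K , vertex i 2 2<K , vertex i 3 3<K ,
    Edge⇒E (Edge-vertex i 0<K 1<K (n⋖1+n 0)) ,
    Edge⇒E (Edge-vertex i 1<K 2<K (n⋖1+n 1)) ,
    Edge⇒E (Edge-vertex i 2<K 3<K (n⋖1+n 2))
    where
    3<K = 4≤K
    2<K = <-trans (n<1+n 2) 3<K
    1<K = <-trans (n<1+n 1) 2<K
    0<K = <-trans (n<1+n 0) 1<K

  SameNeighbourhoods : Fin n → Fin n → Set
  SameNeighbourhoods x y = (∀ z → adj x z ≡ adj y z) × (∀ z → adj z x ≡ adj z y)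

  SameNeighbourhoods⇒copy≡ : 1 < K → ∀ {x y} → SameNeighbourhoods x y → copy x ≡ copy y
  SameNeighbourhoods⇒copy≡ 1<K {x} {y} (sameOut , sameIn)
    with ⋖-neighbour (level x) 1<K (toℕ<n _)
  ... | b , b<K , inj₁ x⋖b =
    let x~z = Edge-to-vertex x b<K x⋖b
    in trans (proj₁ x~z) (sym (proj₁ (Edge-resp-adj (sameOut _) x~z)))
  ... | b , b<K , inj₂ b⋖x =
    let z~x = Edge-from-vertex x b<K b⋖x
    in trans (sym (proj₁ z~x)) (proj₁ (Edge-resp-adj (sameIn _) z~x))

  SameNeighbourhoods⇒level≮ : ∀ {x y} → SameNeighbourhoods x y → ¬ level x < level y
  SameNeighbourhoods⇒level≮ {x} {y} (sameOut , _) x<y =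
    let (c , c<K , x⋖c , ¬y⋖c) = ⋖-separating x<y (toℕ<n (proj₂ (to y)))
        (_ , y⋖z) = Edge-resp-adj (sameOut _) (Edge-to-vertex x c<K x⋖c)
    in ¬y⋖c (subst (level y ⋖_) (level-vertex (copy x) c c<K) y⋖z)

  thin : 1 < K → Thin G
  thin 1<K x y x≢y same@(sameOut , sameIn) = x≢y (Injection.injective (↔⇒↣ split) to≡)
    where
    level≡ : level x ≡ level y
    level≡ = ≤-antisym (≮⇒≥ (SameNeighbourhoods⇒level≮ (sym ∘ sameOut , sym ∘ sameIn)))
                       (≮⇒≥ (SameNeighbourhoods⇒level≮ same))
    to≡ : to x ≡ to y
    to≡ = cong₂ _,_ (SameNeighbourhoods⇒copy≡ 1<K same) (toℕ-injective level≡)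

  onCopies : (Fin m → Fin m) → Fin n → Fin n
  onCopies f v = from (map₁ f (to v))

  copy-onCopies : ∀ f v → copy (onCopies f v) ≡ f (copy v)
  copy-onCopies f v = cong proj₁ (strictlyInverseˡ _)

  level-onCopies : ∀ f v → level (onCopies f v) ≡ level v
  level-onCopies f v = cong (toℕ ∘ proj₂) (strictlyInverseˡ _)

  onCopies-∘ : ∀ f g v → onCopies (g ∘ f) v ≡ onCopies g (onCopies f v)
  onCopies-∘ f g v = cong (from ∘ map₁ g) (sym (strictlyInverseˡ _))

  onCopies-cancel : ∀ f g → (∀ i → f (g i) ≡ i) → ∀ v → onCopies f (onCopies g v) ≡ v
  onCopies-cancel f g fg v = begin
    onCopies f (onCopies g v)  ≡⟨ onCopies-∘ g f v ⟨
    from (map₁ (f ∘ g) (to v)) ≡⟨ cong (λ i → from (i , proj₂ (to v))) (fg (copy v)) ⟩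
    from (to v)                ≡⟨ strictlyInverseʳ v ⟩
    v                          ∎
    where open ≡-Reasoning

  onCopies-Edge : ∀ f {u v} → Edge u v → Edge (onCopies f u) (onCopies f v)
  onCopies-Edge f {u} {v} (u≈v , u⋖v) =
    trans (copy-onCopies f u) (trans (cong f u≈v) (sym (copy-onCopies f v))) ,
    subst₂ _⋖_ (sym (level-onCopies f u)) (sym (level-onCopies f v)) u⋖v

  relabel : Permutation′ m → Permutation′ n
  relabel σ = permutation (onCopies to′) (onCopies from′)
                (onCopies-cancel to′ from′ λ _ → inverseʳ σ) (onCopies-cancel from′ to′ λ _ → inverseˡ σ)
    where
    to′ = σ ⟨$⟩ʳ_
    from′ = σ ⟨$⟩ˡ_

  relabel-isColAut : ∀ σ → IsColAut G (relabel σ)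
  relabel-isColAut σ = (λ v → cong isEven (level-onCopies (σ ⟨$⟩ʳ_) v)) ,
                       (λ u v → Edge⇒E ∘ onCopies-Edge (σ ⟨$⟩ʳ_) ∘ E⇒Edge)

  relabel-∘ : ∀ σ τ v → relabel (σ ∘ₚ τ) ⟨$⟩ʳ v ≡ (relabel σ ∘ₚ relabel τ) ⟨$⟩ʳ v
  relabel-∘ σ τ = onCopies-∘ (σ ⟨$⟩ʳ_) (τ ⟨$⟩ʳ_)

  relabel-injective : Fin K → ∀ σ τ → (∀ v → relabel σ ⟨$⟩ʳ v ≡ relabel τ ⟨$⟩ʳ v) →
                      ∀ i → σ ⟨$⟩ʳ i ≡ τ ⟨$⟩ʳ i
  relabel-injective j σ τ σ≗τ i = begin
    σ ⟨$⟩ʳ i                 ≡⟨ cong (σ ⟨$⟩ʳ_) (copy-from i j) ⟨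
    σ ⟨$⟩ʳ copy v            ≡⟨ copy-onCopies (σ ⟨$⟩ʳ_) v ⟨
    copy (relabel σ ⟨$⟩ʳ v)  ≡⟨ cong copy (σ≗τ v) ⟩
    copy (relabel τ ⟨$⟩ʳ v)  ≡⟨ copy-onCopies (τ ⟨$⟩ʳ_) v ⟩
    τ ⟨$⟩ʳ copy v            ≡⟨ cong (τ ⟨$⟩ʳ_) (copy-from i j) ⟩
    τ ⟨$⟩ʳ i                 ∎
    where
    open ≡-Reasoning
    v = from (i , j)

copies×levels : ∀ m s → Fin (2 * m * s) ↔ (Fin m × Fin (2 * s))
copies×levels m s = subst (λ k → Fin k ↔ (Fin m × Fin (2 * s))) (sym 2ms≡m[2s]) *↔×
  where
  2ms≡m[2s] : 2 * m * s ≡ m * (2 * s)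
  2ms≡m[2s] = trans (cong (_* s) (*-comm 2 m)) (*-assoc m 2 s)

theorem5p8 : (m s : ℕ) → 2 ≤ m → 2 ≤ s →
    Σ (ColDigraph (2 * m * s)) λ G →
      Is2qBMG G × Proper G × Thin G × ContainsSym G m
theorem5p8 m s (s≤s _) 2≤s@(s≤s _) =
  G , is2qBMG , proper 0F 4≤2s , thin (*-monoʳ-≤ 2 (s≤s z≤n)) ,
  relabel , relabel-isColAut , relabel-∘ , relabel-injective 0F
  where
  open CopiesOfAlternatingPath (copies×levels m s)
  4≤2s : 4 ≤ 2 * s
  4≤2s = *-monoʳ-≤ 2 2≤s
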